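{- Let $k\ge 1$ be an integer and let $m=6k+19$. Let $S$ be the numerical semigroup (of multiplicity $m$) whose gapset is $$G=\mathbb N\setminus S=\{1,2,\dots,m-1\}\cup\{2m-7,\,2m-6,\,2m-2,\,2m-1\}.$$ Then $\mathrm{B}(S)=\{3,4,\dots,k+3\}$.
   Context: $\mathbb N=\{0,1,2,\dots\}$. A numerical semigroup is a subset $S\subseteq\mathbb N$ containing $0$, closed under addition, with finite complement (its gapset). For a finite set $A\subset\mathbb Z$ and $n\ge1$, $nA$ is the $n$-fold sumset: $1A=A$, $nA=A+(n-1)A$, where $X+Y=\{x+y\mid x\in X, y\in Y\}$. For a numerical semigroup $S$ with gapset $G=\mathbb N\setminus S$, its Buchweitz set is $\mathrm{B}(S)=\{n\ge 2 \mid |nG| > (2n-1)(|G|-1)\}$. -}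

module Defs where

open import Data.Nat using (ℕ; zero; suc; _+_; _*_; _∸_; _≤_; _<_; _≟_)
open import Data.List using (List; []; _∷_; map; concatMap; length; upTo; deduplicate)
open import Data.List.Membership.Propositional using (_∈_)
open import Data.Product using (_×_; ∃-syntax)
open import Relation.Nullary using (¬_)

-- Finite subsets of ℕ are represented by lists (duplicates allowed);
-- the cardinality |A| is the number of distinct entries.
card : List ℕ → ℕ
card A = length (deduplicate _≟_ A)

_⊕_ : List ℕ → List ℕ → List ℕ
X ⊕ Y = concatMap (λ x → map (x +_) Y) X

-- n-fold sumset, defined for n ≥ 1 : 1A = A, nA = A + (n-1)A.
-- For n = 0 we (arbitrarily) also return A; it is never used since B(S) only involves n ≥ 2.
fold : ℕ → List ℕ → List ℕ
fold zero A = A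
fold (suc zero) A = A
fold (suc (suc n)) A = A ⊕ fold (suc n) A

record IsNumericalSemigroup (S : ℕ → Set) : Set where
  field
    zero∈ : S 0
    +-closed : ∀ x y → S x → S y → S (x + y)
    cofinite : ∃[ b ] (∀ x → b ≤ x → S x)

IsGapsetOf : List ℕ → (ℕ → Set) → Set
IsGapsetOf G S = ∀ x → (x ∈ G → ¬ S x) × (¬ S x → x ∈ G)

InBuchweitz : List ℕ → ℕ → Set
InBuchweitz G n = 2 ≤ n × (2 * n ∸ 1) * (card G ∸ 1) < card (fold n G)

mult : ℕ → ℕ
mult k = 6 * k + 19

gapset : ℕ → List ℕ
gapset k = map suc (upTo (mult k ∸ 1))
  Data.List.++ (2 * mult k ∸ 7 ∷ 2 * mult k ∸ 6 ∷ 2 * mult k ∸ 2 ∷ 2 * mult k ∸ 1 ∷ [])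

S : ℕ → ℕ → Set
S k x = ¬ (x ∈ gapset k)

-- Write the gapset as G = [1, c] ∪ (Q + D) with c = m - 1, Q = 2m - 7 and D = {0, 1, 5, 6}, so
-- that |G| - 1 = c + 3. For n ≥ 2 the sumset nG contains the interval [n, (n-1)(Q+6) + c]
-- (by induction on n, since Q ≤ 2c) and the block nQ + nD, where 3D has 16 elements and
-- nD = [0, 6n] for n ≥ 4. These two pieces are disjoint as long as 6(n-1) + c < Q, i.e.
-- n ≤ k + 3, and then |nG| beats (2n-1)(c+3) by 1 (n = 3) or 4 (n ≥ 4). For larger n,
-- nG ⊆ [n, n(Q+6)] is too small, and 2G ⊆ [2, c+Q+6] ∪ (2Q + 2D) with |2D| = 9 meets the
-- bound exactly.
module Submission where

open import Defs
open import Data.Nat using (ℕ; zero; suc; _+_; _*_; _∸_; _≤_; _<_; z≤n; s≤s; _≤?_; _≟_)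
open import Data.Nat.Properties
open import Data.Nat.Tactic.RingSolver using (solve)
open import Data.Product using (_×_; _,_; proj₁; proj₂; ∃-syntax)
open import Data.Sum using (inj₁; inj₂)
open import Data.Empty using (⊥-elim)
open import Data.List using (List; []; _∷_; _++_; map; length; upTo; deduplicate)
open import Data.List.Properties using (length-++; length-map; length-upTo)
open import Data.List.Membership.DecPropositional _≟_ using (_∈?_)
open import Data.List.Membership.Propositional using (_∈_; find)
open import Data.List.Membership.Propositional.Properties
  using (∈-map⁺; ∈-map⁻; ∈-++⁺ˡ; ∈-++⁺ʳ; ∈-++⁻; ∈-∃++; ∈-concatMap⁺; ∈-concatMap⁻; ∈-upTo⁺; ∈-upTo⁻;
         ∈-deduplicate⁺; ∈-deduplicate⁻)
open import Data.List.Relation.Binary.Permutation.Propositional.Properties using (↭-length; shift)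
open import Data.List.Relation.Binary.Subset.Propositional using (_⊆_)
open import Data.List.Relation.Unary.All as All using (all?)
open import Data.List.Relation.Unary.AllPairs using (_∷_)
open import Data.List.Relation.Unary.Any as Any using (here; there)
open import Data.List.Relation.Unary.Unique.DecPropositional _≟_ using (unique?)
open import Data.List.Relation.Unary.Unique.DecPropositional.Properties _≟_ using (deduplicate-!)
open import Data.List.Relation.Unary.Unique.Propositional using (Unique)
open import Data.List.Relation.Unary.Unique.Propositional.Properties using (map⁺; ++⁺; upTo⁺)
open import Function.Bundles using (_⇔_; mk⇔)
open import Relation.Binary.PropositionalEquality
open import Relation.Nullary using (¬_; yes; no)
open import Relation.Nullary.Decidable using (from-yes; decidable-stable)

m+o≡n⇒m≤n : ∀ {m n} o → m + o ≡ n → m ≤ n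
m+o≡n⇒m≤n {m} o refl = m≤m+n m o

unique⊆⇒length≤ : {xs ys : List ℕ} → Unique xs → xs ⊆ ys → length xs ≤ length ys
unique⊆⇒length≤ {[]} _ _ = z≤n
unique⊆⇒length≤ {x ∷ xs} (x∉xs ∷ xs!) xs⊆ys
  with ys₁ , ys₂ , refl ← ∈-∃++ (xs⊆ys (here refl)) =
  ≤-trans (s≤s (unique⊆⇒length≤ xs! xs⊆ys₁++ys₂)) (≤-reflexive (sym (↭-length (shift x ys₁ ys₂))))
  where
  xs⊆ys₁++ys₂ : xs ⊆ ys₁ ++ ys₂
  xs⊆ys₁++ys₂ y∈xs with ∈-++⁻ ys₁ (xs⊆ys (there y∈xs))
  ... | inj₁ y∈ys₁ = ∈-++⁺ˡ y∈ys₁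
  ... | inj₂ (here refl) = ⊥-elim (All.lookup x∉xs y∈xs refl)
  ... | inj₂ (there y∈ys₂) = ∈-++⁺ʳ ys₁ y∈ys₂

card-≥ : {U A : List ℕ} → Unique U → U ⊆ A → length U ≤ card A
card-≥ U! U⊆A = unique⊆⇒length≤ U! (λ x∈U → ∈-deduplicate⁺ _≟_ (U⊆A x∈U))

card-≤ : {A V : List ℕ} → A ⊆ V → card A ≤ length V
card-≤ {A} A⊆V = unique⊆⇒length≤ (deduplicate-! A) (λ x∈ → A⊆V (∈-deduplicate⁻ _≟_ A x∈))

card-unique : {A : List ℕ} → Unique A → card A ≡ length A
card-unique {A} A! = ≤-antisym (card-≤ {A} (λ x∈A → x∈A)) (card-≥ A! (λ x∈A → x∈A))

++⁺-< : {xs ys : List ℕ} → Unique xs → Unique ys → (∀ {x y} → x ∈ xs → y ∈ ys → x < y) →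
        Unique (xs ++ ys)
++⁺-< xs! ys! xs<ys = ++⁺ xs! ys! (λ (x∈xs , x∈ys) → <-irrefl refl (xs<ys x∈xs x∈ys))

interval : ℕ → ℕ → List ℕ
interval a l = map (a +_) (upTo l)

∈-interval⁺ : ∀ {a l x} → a ≤ x → x < a + l → x ∈ interval a l
∈-interval⁺ {a} {l} {x} a≤x x<a+l =
  subst (_∈ interval a l) a+[x∸a]≡x (∈-map⁺ (a +_) (∈-upTo⁺ x∸a<l))
  where
  a+[x∸a]≡x : a + (x ∸ a) ≡ x
  a+[x∸a]≡x = m+[n∸m]≡n a≤x
  x∸a<l : x ∸ a < l
  x∸a<l = +-cancelˡ-< a (x ∸ a) l (subst (_< a + l) (sym a+[x∸a]≡x) x<a+l)

∈-interval⁻ : ∀ {a l x} → x ∈ interval a l → a ≤ x × x < a + l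
∈-interval⁻ {a} x∈ with i , i<l , refl ← ∈-map⁻ (a +_) x∈ = m≤m+n a i , +-monoʳ-< a (∈-upTo⁻ i<l)

interval-unique : ∀ a l → Unique (interval a l)
interval-unique a l = map⁺ (+-cancelˡ-≡ a _ _) (upTo⁺ l)

length-interval : ∀ a l → length (interval a l) ≡ l
length-interval a l = trans (length-map (a +_) (upTo l)) (length-upTo l)

∈-⊕⁺ : ∀ {X Y : List ℕ} {a b} → a ∈ X → b ∈ Y → a + b ∈ X ⊕ Y
∈-⊕⁺ {Y = Y} a∈X b∈Y =
  ∈-concatMap⁺ (λ x → map (x +_) Y) (Any.map (λ { refl → ∈-map⁺ (_ +_) b∈Y }) a∈X)

∈-⊕⁻ : ∀ (X Y : List ℕ) {z} → z ∈ X ⊕ Y → ∃[ a ] ∃[ b ] (a ∈ X × b ∈ Y × z ≡ a + b)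
∈-⊕⁻ X Y z∈ with find (∈-concatMap⁻ (λ x → map (x +_) Y) {xs = X} z∈)
... | a , a∈X , z∈a+Y with ∈-map⁻ (a +_) z∈a+Y
...   | b , b∈Y , z≡a+b = a , b , a∈X , b∈Y , z≡a+b

Covers : List ℕ → ℕ → ℕ → Set
Covers X a b = ∀ {x} → a ≤ x → x ≤ b → x ∈ X

covers-point : ∀ {X a} → a ∈ X → Covers X a a
covers-point a∈X a≤x x≤a rewrite ≤-antisym x≤a a≤x = a∈X

covers-∪ : ∀ {X a b c d} → Covers X a b → Covers X c d → c ≤ suc b → Covers X a d
covers-∪ {b = b} cov₁ cov₂ c≤1+b {x} a≤x x≤d with x ≤? b
... | yes x≤b = cov₁ a≤x x≤b
... | no x≰b = cov₂ (≤-trans c≤1+b (≰⇒> x≰b)) x≤d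

covers-⊕ : ∀ {X Y a₁ b₁ a₂ b₂} → Covers X a₁ b₁ → Covers Y a₂ b₂ → a₁ ≤ b₁ → a₂ ≤ b₂ →
           Covers (X ⊕ Y) (a₁ + a₂) (b₁ + b₂)
covers-⊕ {a₁ = a₁} {b₁} {a₂} {b₂} covX covY a₁≤b₁ a₂≤b₂ {x} lo hi with x ≤? b₁ + a₂
... | yes x≤b₁+a₂ = subst (_∈ _) (m∸n+n≡m a₂≤x) (∈-⊕⁺ (covX lo′ hi′) (covY ≤-refl a₂≤b₂))
  where
  a₂≤x : a₂ ≤ x
  a₂≤x = ≤-trans (m≤n+m a₂ a₁) lo
  lo′ : a₁ ≤ x ∸ a₂
  lo′ = subst (_≤ x ∸ a₂) (m+n∸n≡m a₁ a₂) (∸-monoˡ-≤ a₂ lo)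
  hi′ : x ∸ a₂ ≤ b₁
  hi′ = subst (x ∸ a₂ ≤_) (m+n∸n≡m b₁ a₂) (∸-monoˡ-≤ a₂ x≤b₁+a₂)
... | no x≰b₁+a₂ = subst (_∈ _) (m+[n∸m]≡n b₁≤x) (∈-⊕⁺ (covX a₁≤b₁ ≤-refl) (covY lo′ hi′))
  where
  b₁+a₂<x : b₁ + a₂ < x
  b₁+a₂<x = ≰⇒> x≰b₁+a₂
  b₁≤x : b₁ ≤ x
  b₁≤x = ≤-trans (m≤m+n b₁ a₂) (<⇒≤ b₁+a₂<x)
  lo′ : a₂ ≤ x ∸ b₁
  lo′ = subst (_≤ x ∸ b₁) (m+n∸m≡n b₁ a₂) (∸-monoˡ-≤ b₁ (<⇒≤ b₁+a₂<x))
  hi′ : x ∸ b₁ ≤ b₂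
  hi′ = subst (x ∸ b₁ ≤_) (m+n∸m≡n b₁ b₂) (∸-monoˡ-≤ b₁ hi)

covers⇒interval⊆ : ∀ {X a b l} → Covers X a b → a + l ≤ suc b → interval a l ⊆ X
covers⇒interval⊆ cov a+l≤1+b x∈ with a≤x , x<a+l ← ∈-interval⁻ x∈ =
  cov a≤x (≤-pred (≤-trans x<a+l a+l≤1+b))

fold-bounds : ∀ {A : List ℕ} {a b} → (∀ {x} → x ∈ A → a ≤ x × x ≤ b) →
              ∀ n {x} → x ∈ fold (suc n) A → suc n * a ≤ x × x ≤ suc n * b
fold-bounds {a = a} {b} bounds zero x∈A
  rewrite *-identityˡ a | *-identityˡ b = bounds x∈A
fold-bounds {A} bounds (suc n) x∈ with y , z , y∈A , z∈ , refl ← ∈-⊕⁻ A (fold (suc n) A) x∈ =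
  +-mono-≤ (proj₁ (bounds y∈A)) (proj₁ (fold-bounds bounds n z∈)) ,
  +-mono-≤ (proj₂ (bounds y∈A)) (proj₂ (fold-bounds bounds n z∈))

card-fold-≤ : ∀ {A : List ℕ} {a w} → (∀ {x} → x ∈ A → a ≤ x × x ≤ a + w) →
              ∀ n → card (fold (suc n) A) ≤ suc (suc n * w)
card-fold-≤ {A} {a} {w} bounds n =
  subst (card (fold (suc n) A) ≤_) (length-interval (suc n * a) (suc (suc n * w))) (card-≤ fold⊆interval)
  where
  fold⊆interval : fold (suc n) A ⊆ interval (suc n * a) (suc (suc n * w))
  fold⊆interval x∈ with lo , hi ← fold-bounds bounds n x∈ =
    ∈-interval⁺ lo (≤-trans (s≤s (≤-trans hi (≤-reflexive (*-distribˡ-+ (suc n) a w))))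
                            (≤-reflexive (sym (+-suc (suc n * a) (suc n * w)))))

fold-shift : ∀ {D A : List ℕ} {c} → (∀ {x} → x ∈ D → c + x ∈ A) →
             ∀ n {x} → x ∈ fold (suc n) D → suc n * c + x ∈ fold (suc n) A
fold-shift {c = c} shift zero {x} x∈D rewrite *-identityˡ c = shift x∈D
fold-shift {D} {A} {c} shift (suc n) x∈ with y , z , y∈D , z∈ , refl ← ∈-⊕⁻ D (fold (suc n) D) x∈ =
  subst (_∈ fold (2 + n) A) (regroup (suc n * c)) (∈-⊕⁺ (shift y∈D) (fold-shift shift n z∈))
  where
  regroup : ∀ nc → (c + y) + (nc + z) ≡ (c + nc) + (y + z)
  regroup nc = solve (c ∷ y ∷ nc ∷ z ∷ [])

-- (n+2)A ⊇ ([1, c] ∪ {Q, Q + d}) + [n+1, t] with t = n(Q+d) + c, and the three translates of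
-- [n+1, t] overlap because Q ≤ 2c and d ≤ c.
fold-covers-initial : ∀ {A : List ℕ} {c Q d} → Covers A 1 c → Q ∈ A → Q + d ∈ A →
                      1 ≤ c → c < Q → Q ≤ 2 * c → d ≤ c →
                      ∀ n → Covers (fold (suc n) A) (suc n) (n * (Q + d) + c)
fold-covers-initial cov _ _ _ _ _ _ zero = cov
fold-covers-initial {A} {c} {Q} {d} cov Q∈A Q+d∈A 1≤c c<Q Q≤2c d≤c (suc n) =
  subst (Covers _ _) (sym (+-assoc (Q + d) (n * (Q + d)) c))
    (covers-∪ (covers-∪ low middle low-middle) high middle-high)
  where
  t : ℕ
  t = n * (Q + d) + c
  previous : Covers (fold (suc n) A) (suc n) t
  previous = fold-covers-initial cov Q∈A Q+d∈A 1≤c c<Q Q≤2c d≤c n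
  n≤n[Q+d] : n ≤ n * (Q + d)
  n≤n[Q+d] = ≤-trans (≤-reflexive (sym (*-identityʳ n)))
                     (*-monoʳ-≤ n (≤-trans (≤-<-trans z≤n c<Q) (m≤m+n Q d)))
  1+n≤t : suc n ≤ t
  1+n≤t = ≤-trans (≤-reflexive (+-comm 1 n)) (+-mono-≤ n≤n[Q+d] 1≤c)
  low : Covers (A ⊕ fold (suc n) A) (1 + suc n) (c + t)
  low = covers-⊕ cov previous 1≤c 1+n≤t
  middle : Covers (A ⊕ fold (suc n) A) (Q + suc n) (Q + t)
  middle = covers-⊕ (covers-point Q∈A) previous ≤-refl 1+n≤t
  high : Covers (A ⊕ fold (suc n) A) ((Q + d) + suc n) ((Q + d) + t)
  high = covers-⊕ (covers-point Q+d∈A) previous ≤-refl 1+n≤t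
  low-middle : Q + suc n ≤ suc (c + t)
  low-middle = begin
    Q + suc n                  ≡⟨ +-suc Q n ⟩
    suc (Q + n)                ≤⟨ s≤s (+-mono-≤ Q≤2c n≤n[Q+d]) ⟩
    suc (2 * c + n * (Q + d))  ≡⟨ cong suc regroup ⟩
    suc (c + t)                ∎
    where
    open ≤-Reasoning
    regroup : 2 * c + n * (Q + d) ≡ c + (n * (Q + d) + c)
    regroup = solve (c ∷ n ∷ Q ∷ d ∷ [])
  middle-high : (Q + d) + suc n ≤ suc (Q + t)
  middle-high = begin
    (Q + d) + suc n            ≡⟨ solve (Q ∷ d ∷ n ∷ []) ⟩
    suc (Q + (d + n))          ≤⟨ s≤s (+-monoʳ-≤ Q (+-mono-≤ d≤c n≤n[Q+d])) ⟩
    suc (Q + (c + n * (Q + d))) ≡⟨ cong (λ u → suc (Q + u)) (+-comm c (n * (Q + d))) ⟩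
    suc (Q + t)                ∎
    where open ≤-Reasoning

offsets : List ℕ
offsets = 0 ∷ 1 ∷ 5 ∷ 6 ∷ []

offsets≤6 : ∀ {s} → s ∈ offsets → s ≤ 6
offsets≤6 = All.lookup (from-yes (all? (_≤? 6) offsets))

fold-offsets-covers : ∀ j → Covers (fold (4 + j) offsets) 0 (6 * (4 + j))
fold-offsets-covers zero {x} _ x≤24 =
  All.lookup (from-yes (all? (_∈? fold 4 offsets) (upTo 25))) (∈-upTo⁺ (s≤s x≤24))
fold-offsets-covers (suc j) =
  subst (Covers _ 0) (sym (*-suc 6 (4 + j)))
    (covers-∪ (covers-⊕ covers-0-1 previous z≤n z≤n) (covers-⊕ covers-5-6 previous (n≤1+n 5) z≤n)
              (s≤s (s≤s (s≤s (s≤s (s≤s z≤n))))))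
  where
  previous : Covers (fold (4 + j) offsets) 0 (6 * (4 + j))
  previous = fold-offsets-covers j
  covers-0-1 : Covers offsets 0 1
  covers-0-1 = covers-∪ (covers-point (here refl)) (covers-point (there (here refl))) ≤-refl
  covers-5-6 : Covers offsets 5 6
  covers-5-6 = covers-∪ (covers-point (there (there (here refl))))
                        (covers-point (there (there (there (here refl))))) ≤-refl

-- The case j = 0 is evaluation: |3·offsets| = 16.
card-fold-offsets : ∀ j → 6 * (2 + j) + 3 < card (fold (3 + j) offsets)
card-fold-offsets zero = ≤-refl
card-fold-offsets (suc j) = begin-strict
  6 * (3 + j) + 3              <⟨ m+o≡n⇒m≤n 3 (solve (j ∷ [])) ⟩
  suc (6 * (4 + j))            ≡⟨ length-interval 0 _ ⟨
  length (interval 0 (suc (6 * (4 + j))))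
    ≤⟨ card-≥ (interval-unique 0 _) (covers⇒interval⊆ (fold-offsets-covers j) ≤-refl) ⟩
  card (fold (4 + j) offsets)  ∎
  where open ≤-Reasoning

gaps : ℕ → ℕ → List ℕ
gaps c Q = interval 1 c ++ map (Q +_) offsets

gaps-covers-initial : ∀ {c Q} → Covers (gaps c Q) 1 c
gaps-covers-initial 1≤x x≤c = ∈-++⁺ˡ (∈-interval⁺ 1≤x (s≤s x≤c))

Q+offset∈gaps : ∀ {c Q s} → s ∈ offsets → Q + s ∈ gaps c Q
Q+offset∈gaps {c} {Q} s∈ = ∈-++⁺ʳ (interval 1 c) (∈-map⁺ (Q +_) s∈)

gaps-bounds : ∀ {c Q x} → c < Q → x ∈ gaps c Q → 1 ≤ x × x ≤ Q + 6
gaps-bounds {c} {Q} c<Q x∈ with ∈-++⁻ (interval 1 c) x∈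
... | inj₁ x∈I with lo , hi ← ∈-interval⁻ x∈I =
  lo , ≤-trans (≤-pred hi) (≤-trans (<⇒≤ c<Q) (m≤m+n Q 6))
... | inj₂ x∈Q+D with s , s∈ , refl ← ∈-map⁻ (Q +_) x∈Q+D =
  ≤-trans (≤-<-trans z≤n c<Q) (m≤m+n Q s) , +-monoʳ-≤ Q (offsets≤6 s∈)

card-gaps : ∀ {c Q} → c < Q → card (gaps c Q) ≡ c + 4
card-gaps {c} {Q} c<Q = begin
  card (gaps c Q)   ≡⟨ card-unique gaps-unique ⟩
  length (gaps c Q) ≡⟨ length-++ (interval 1 c) ⟩
  length (interval 1 c) + 4 ≡⟨ cong (_+ 4) (length-interval 1 c) ⟩
  c + 4             ∎
  where
  open ≡-Reasoning
  gaps-unique : Unique (gaps c Q)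
  gaps-unique = ++⁺-< (interval-unique 1 c) (map⁺ (+-cancelˡ-≡ Q _ _) (from-yes (unique? offsets))) I<Q+D
    where
    I<Q+D : ∀ {x y} → x ∈ interval 1 c → y ∈ map (Q +_) offsets → x < y
    I<Q+D x∈ y∈ with s , _ , refl ← ∈-map⁻ (Q +_) y∈ =
      ≤-trans (proj₂ (∈-interval⁻ x∈)) (≤-trans c<Q (m≤m+n Q s))

fold-gaps-covers-initial : ∀ {c Q} → c < Q → Q + 5 ≤ 2 * c →
                           ∀ p → Covers (fold (suc p) (gaps c Q)) (suc p) (p * (Q + 6) + c)
fold-gaps-covers-initial {c} {Q} c<Q Q+5≤2c =
  fold-covers-initial gaps-covers-initial Q∈gaps (Q+offset∈gaps (there (there (there (here refl)))))
    (≤-trans (s≤s z≤n) 6≤c) c<Q (≤-trans (m≤m+n Q 5) Q+5≤2c) 6≤c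
  where
  Q∈gaps : Q ∈ gaps c Q
  Q∈gaps = subst (_∈ gaps c Q) (+-identityʳ Q) (Q+offset∈gaps (here refl))
  6≤c : 6 ≤ c
  6≤c = +-cancelˡ-≤ c 6 c (begin
    c + 6     ≡⟨ +-suc c 5 ⟩
    suc c + 5 ≤⟨ +-monoˡ-≤ 5 c<Q ⟩
    Q + 5     ≤⟨ Q+5≤2c ⟩
    2 * c     ≡⟨ cong (c +_) (+-identityʳ c) ⟩
    c + c     ∎)
    where open ≤-Reasoning

-- (p+1)G contains [p+1, p(Q+6) + c] and, beyond it, the translate (p+1)Q + (p+1)·offsets.
card-fold-gaps-≥ : ∀ {c Q} → c < Q → Q + 5 ≤ 2 * c → ∀ p → p * (Q + 6) + c < suc p * Q →
                   p * (Q + 5) + c + card (fold (suc p) offsets) ≤ card (fold (suc p) (gaps c Q))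
card-fold-gaps-≥ {c} {Q} c<Q Q+5≤2c p separated = begin
  L + card (fold (suc p) offsets)
    ≡⟨ cong₂ _+_ (length-interval (suc p) L) (length-map (suc p * Q +_) translate) ⟨
  length low + length high         ≡⟨ length-++ low ⟨
  length (low ++ high)             ≤⟨ card-≥ low++high-unique low++high⊆ ⟩
  card (fold (suc p) (gaps c Q))   ∎
  where
  open ≤-Reasoning
  L : ℕ
  L = p * (Q + 5) + c
  translate : List ℕ
  translate = deduplicate _≟_ (fold (suc p) offsets)
  low high : List ℕ
  low = interval (suc p) L
  high = map (suc p * Q +_) translate
  end-of-low : suc p + (p * (Q + 5) + c) ≡ suc (p * (Q + 6) + c)
  end-of-low = solve (p ∷ Q ∷ c ∷ [])
  low<high : ∀ {x y} → x ∈ low → y ∈ high → x < y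
  low<high x∈ y∈ with s , _ , refl ← ∈-map⁻ (suc p * Q +_) y∈ =
    ≤-trans (proj₂ (∈-interval⁻ x∈))
            (≤-trans (≤-reflexive end-of-low) (≤-trans separated (m≤m+n _ s)))
  low++high-unique : Unique (low ++ high)
  low++high-unique = ++⁺-< (interval-unique (suc p) L) (map⁺ (+-cancelˡ-≡ _ _ _) (deduplicate-! _)) low<high
  low++high⊆ : low ++ high ⊆ fold (suc p) (gaps c Q)
  low++high⊆ y∈ with ∈-++⁻ low y∈
  ... | inj₁ y∈low =
    covers⇒interval⊆ (fold-gaps-covers-initial c<Q Q+5≤2c p) (≤-reflexive end-of-low) y∈low
  ... | inj₂ y∈high with s , s∈ , refl ← ∈-map⁻ (suc p * Q +_) y∈high =
    fold-shift Q+offset∈gaps p (∈-deduplicate⁻ _≟_ _ s∈)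

card-fold₂-gaps-≤ : ∀ {c Q} → c < Q → card (fold 2 (gaps c Q)) ≤ c + (Q + 5) + 9
card-fold₂-gaps-≤ {c} {Q} c<Q = begin
  card (fold 2 (gaps c Q))                            ≤⟨ card-≤ fold₂⊆ ⟩
  length (low ++ high)                                ≡⟨ length-++ low ⟩
  length low + length high
    ≡⟨ cong₂ _+_ (length-interval 2 _) (length-map ((Q + Q) +_) translate) ⟩
  c + (Q + 5) + 9                                     ∎
  where
  open ≤-Reasoning
  translate : List ℕ
  translate = deduplicate _≟_ (fold 2 offsets)
  low high : List ℕ
  low = interval 2 (c + (Q + 5))
  high = map ((Q + Q) +_) translate
  sum∈low : ∀ {x y} → 1 ≤ x → 1 ≤ y → x + y ≤ c + (Q + 6) → x + y ∈ low ++ high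
  sum∈low 1≤x 1≤y x+y≤ =
    ∈-++⁺ˡ (∈-interval⁺ (+-mono-≤ 1≤x 1≤y) (≤-trans (s≤s x+y≤) (≤-reflexive end-of-low)))
    where
    end-of-low : suc (c + (Q + 6)) ≡ 2 + (c + (Q + 5))
    end-of-low = solve (c ∷ Q ∷ [])
  fold₂⊆ : fold 2 (gaps c Q) ⊆ low ++ high
  fold₂⊆ x∈ with y , z , y∈ , z∈ , refl ← ∈-⊕⁻ (gaps c Q) (gaps c Q) x∈
    with 1≤y , y≤Q+6 ← gaps-bounds c<Q y∈ | 1≤z , z≤Q+6 ← gaps-bounds c<Q z∈
    with ∈-++⁻ (interval 1 c) y∈ | ∈-++⁻ (interval 1 c) z∈
  ... | inj₁ y∈I | _ = sum∈low 1≤y 1≤z (+-mono-≤ (≤-pred (proj₂ (∈-interval⁻ y∈I))) z≤Q+6)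
  ... | inj₂ _ | inj₁ z∈I = sum∈low 1≤y 1≤z
        (≤-trans (≤-reflexive (+-comm y z)) (+-mono-≤ (≤-pred (proj₂ (∈-interval⁻ z∈I))) y≤Q+6))
  ... | inj₂ y∈Q+D | inj₂ z∈Q+D
    with s , s∈ , refl ← ∈-map⁻ (Q +_) y∈Q+D | t , t∈ , refl ← ∈-map⁻ (Q +_) z∈Q+D =
    ∈-++⁺ʳ low (subst (_∈ high) regroup
                 (∈-map⁺ ((Q + Q) +_) (∈-deduplicate⁺ _≟_ (∈-⊕⁺ s∈ t∈))))
    where
    regroup : (Q + Q) + (s + t) ≡ (Q + s) + (Q + t)
    regroup = solve (Q ∷ s ∷ t ∷ [])

complement-isNumericalSemigroup : ∀ {A : List ℕ} c → (∀ {x} → x ∈ A → 1 ≤ x × x ≤ suc (2 * c)) →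
                                  Covers A 1 c → IsNumericalSemigroup (λ x → ¬ x ∈ A)
complement-isNumericalSemigroup {A} c bounds cov = record
  { zero∈ = λ 0∈A → <-irrefl refl (proj₁ (bounds 0∈A))
  ; +-closed = closed
  ; cofinite = suc (suc (2 * c)) , λ x above x∈A → <⇒≱ above (proj₂ (bounds x∈A))
  }
  where
  beyond-cover : ∀ {x} → 1 ≤ x → ¬ x ∈ A → c < x
  beyond-cover {x} 1≤x x∉A with x ≤? c
  ... | yes x≤c = ⊥-elim (x∉A (cov 1≤x x≤c))
  ... | no x≰c = ≰⇒> x≰c
  closed : ∀ x y → ¬ x ∈ A → ¬ y ∈ A → ¬ (x + y) ∈ A
  closed zero y _ y∉A = y∉A
  closed (suc x) zero x∉A _ rewrite +-identityʳ x = x∉A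
  closed (suc x) (suc y) x∉A y∉A x+y∈A = <⇒≱ 2c+1<x+y (proj₂ (bounds x+y∈A))
    where
    2c+1<x+y : suc (2 * c) < suc x + suc y
    2c+1<x+y = ≤-trans (≤-reflexive regroup)
                       (+-mono-≤ (beyond-cover (s≤s z≤n) x∉A) (beyond-cover (s≤s z≤n) y∉A))
      where
      regroup : suc (suc (2 * c)) ≡ suc c + suc c
      regroup = solve (c ∷ [])

complement-isGapsetOf : ∀ A → IsGapsetOf A (λ x → ¬ x ∈ A)
complement-isGapsetOf A x = (λ x∈A x∉A → x∉A x∈A) , decidable-stable (x ∈? A)

gaps-isNumericalSemigroup : ∀ {c Q} → c < Q → Q + 5 ≤ 2 * c →
                            IsNumericalSemigroup (λ x → ¬ x ∈ gaps c Q)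
gaps-isNumericalSemigroup {c} {Q} c<Q Q+5≤2c = complement-isNumericalSemigroup c bounds gaps-covers-initial
  where
  bounds : ∀ {x} → x ∈ gaps c Q → 1 ≤ x × x ≤ suc (2 * c)
  bounds x∈ with lo , hi ← gaps-bounds c<Q x∈ =
    lo , ≤-trans hi (≤-trans (≤-reflexive (+-suc Q 5)) (s≤s Q+5≤2c))

buchweitz-threshold : ∀ {c Q} → c < Q →
                      ∀ p → (2 * suc p ∸ 1) * (card (gaps c Q) ∸ 1) ≡ suc (2 * p) * (c + 3)
buchweitz-threshold {c} c<Q p =
  cong₂ _*_ (cong (_∸ 1) (*-suc 2 p)) (trans (cong (_∸ 1) (card-gaps c<Q)) (+-∸-assoc c (s≤s z≤n)))

¬InBuchweitz-gaps-2 : ∀ {c Q} → c < Q → Q + 5 ≤ 2 * c → ¬ InBuchweitz (gaps c Q) 2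
¬InBuchweitz-gaps-2 {c} {Q} c<Q Q+5≤2c (_ , above) = <⇒≱ above (begin
  card (fold 2 (gaps c Q))                   ≤⟨ card-fold₂-gaps-≤ c<Q ⟩
  c + (Q + 5) + 9                            ≤⟨ +-monoˡ-≤ 9 (+-monoʳ-≤ c Q+5≤2c) ⟩
  c + 2 * c + 9                              ≡⟨ regroup ⟩
  3 * (c + 3)                                ≡⟨ buchweitz-threshold c<Q 1 ⟨
  (2 * 2 ∸ 1) * (card (gaps c Q) ∸ 1)        ∎)
  where
  open ≤-Reasoning
  regroup : c + 2 * c + 9 ≡ 3 * (c + 3)
  regroup = solve (c ∷ [])

InBuchweitz-gaps : ∀ {c Q p} → Q + 5 ≡ 2 * c → 1 ≤ p → 6 * p + c < Q →
                   6 * p + 3 < card (fold (suc p) offsets) → InBuchweitz (gaps c Q) (suc p)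
InBuchweitz-gaps {c} {Q} {p} Q+5≡2c 1≤p separated enough-offsets = s≤s 1≤p , (begin-strict
  (2 * suc p ∸ 1) * (card (gaps c Q) ∸ 1)          ≡⟨ buchweitz-threshold c<Q p ⟩
  suc (2 * p) * (c + 3)                            ≡⟨ regroup ⟩
  p * (2 * c) + c + (6 * p + 3)                    <⟨ +-monoʳ-< (p * (2 * c) + c) enough-offsets ⟩
  p * (2 * c) + c + card (fold (suc p) offsets)
    ≡⟨ cong (λ u → p * u + c + card (fold (suc p) offsets)) Q+5≡2c ⟨
  p * (Q + 5) + c + card (fold (suc p) offsets)
    ≤⟨ card-fold-gaps-≥ c<Q (≤-reflexive Q+5≡2c) p separated′ ⟩
  card (fold (suc p) (gaps c Q))                   ∎)
  where
  open ≤-Reasoning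
  regroup : suc (2 * p) * (c + 3) ≡ p * (2 * c) + c + (6 * p + 3)
  regroup = solve (p ∷ c ∷ [])
  c<Q : c < Q
  c<Q = ≤-trans (s≤s (m≤n+m c (6 * p))) separated
  separated′ : p * (Q + 6) + c < suc p * Q
  separated′ = begin-strict
    p * (Q + 6) + c     ≡⟨ regroup′ ⟩
    p * Q + (6 * p + c) <⟨ +-monoʳ-< (p * Q) separated ⟩
    p * Q + Q           ≡⟨ +-comm (p * Q) Q ⟩
    suc p * Q           ∎
    where
    regroup′ : p * (Q + 6) + c ≡ p * Q + (6 * p + c)
    regroup′ = solve (p ∷ Q ∷ c ∷ [])

¬InBuchweitz-gaps : ∀ {c Q p} → c < Q → Q + 5 ≤ 2 * c → c ≤ 6 * p + 2 →
                    ¬ InBuchweitz (gaps c Q) (suc p)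
¬InBuchweitz-gaps {c} {Q} {p} c<Q Q+5≤2c c≤6p+2 (_ , above) = <⇒≱ above (begin
  card (fold (suc p) (gaps c Q))           ≤⟨ card-fold-≤ bounds p ⟩
  suc (suc p * (Q + 5))                    ≤⟨ s≤s (*-monoʳ-≤ (suc p) Q+5≤2c) ⟩
  suc (suc p * (2 * c))                    ≡⟨ regroup ⟩
  suc (2 * p) * c + suc c                  ≤⟨ +-monoʳ-≤ (suc (2 * p) * c) (s≤s c≤6p+2) ⟩
  suc (2 * p) * c + suc (6 * p + 2)        ≡⟨ regroup′ ⟩
  suc (2 * p) * (c + 3)                    ≡⟨ buchweitz-threshold c<Q p ⟨
  (2 * suc p ∸ 1) * (card (gaps c Q) ∸ 1)  ∎)
  where
  open ≤-Reasoning
  regroup : suc (suc p * (2 * c)) ≡ suc (2 * p) * c + suc c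
  regroup = solve (p ∷ c ∷ [])
  regroup′ : suc (2 * p) * c + suc (6 * p + 2) ≡ suc (2 * p) * (c + 3)
  regroup′ = solve (p ∷ c ∷ [])
  bounds : ∀ {x} → x ∈ gaps c Q → 1 ≤ x × x ≤ 1 + (Q + 5)
  bounds x∈ with lo , hi ← gaps-bounds c<Q x∈ = lo , ≤-trans hi (≤-reflexive (+-suc Q 5))

gapset≡gaps : ∀ k → gapset k ≡ gaps (6 * k + 18) (12 * k + 31)
gapset≡gaps k =
  cong₂ _++_ (cong (λ l → map suc (upTo l)) (+-∸-assoc (6 * k) {19} {1} (s≤s z≤n)))
    (cong₂ _∷_ (upper 0 7 (solve (k ∷ []))) (cong₂ _∷_ (upper 1 6 (solve (k ∷ [])))
      (cong₂ _∷_ (upper 5 2 (solve (k ∷ []))) (cong₂ _∷_ (upper 6 1 (solve (k ∷ []))) refl))))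
  where
  upper : ∀ s d → 2 * (6 * k + 19) ≡ (12 * k + 31 + s) + d → 2 * mult k ∸ d ≡ 12 * k + 31 + s
  upper s d 2m≡ = trans (cong (_∸ d) 2m≡) (m+n∸n≡m _ d)

module _ (k : ℕ) where

  c<Q : 6 * k + 18 < 12 * k + 31
  c<Q = m+o≡n⇒m≤n (6 * k + 12) (solve (k ∷ []))

  Q+5≡2c : 12 * k + 31 + 5 ≡ 2 * (6 * k + 18)
  Q+5≡2c = solve (k ∷ [])

  buchweitz-member : ∀ j → j ≤ k → InBuchweitz (gaps (6 * k + 18) (12 * k + 31)) (3 + j)
  buchweitz-member j j≤k = InBuchweitz-gaps Q+5≡2c (s≤s z≤n) separated (card-fold-offsets j)
    where
    open ≤-Reasoning
    separated : 6 * (2 + j) + (6 * k + 18) < 12 * k + 31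
    separated = begin-strict
      6 * (2 + j) + (6 * k + 18) ≤⟨ +-monoˡ-≤ (6 * k + 18) (*-monoʳ-≤ 6 (+-monoʳ-≤ 2 j≤k)) ⟩
      6 * (2 + k) + (6 * k + 18) <⟨ m+o≡n⇒m≤n 0 (solve (k ∷ [])) ⟩
      12 * k + 31                ∎

  buchweitz-nonmember : ∀ j → k < j → ¬ InBuchweitz (gaps (6 * k + 18) (12 * k + 31)) (3 + j)
  buchweitz-nonmember j k<j = ¬InBuchweitz-gaps c<Q (≤-reflexive Q+5≡2c) c≤6p+2
    where
    open ≤-Reasoning
    c≤6p+2 : 6 * k + 18 ≤ 6 * (2 + j) + 2
    c≤6p+2 = begin
      6 * k + 18          ≤⟨ m+o≡n⇒m≤n 2 (solve (k ∷ [])) ⟩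
      6 * (3 + k) + 2     ≤⟨ +-monoˡ-≤ 2 (*-monoʳ-≤ 6 (+-monoʳ-≤ 2 k<j)) ⟩
      6 * (2 + j) + 2     ∎

  buchweitz-set : ∀ n → InBuchweitz (gaps (6 * k + 18) (12 * k + 31)) n ⇔ (3 ≤ n × n ≤ k + 3)
  buchweitz-set 0 = mk⇔ (λ ()) (λ ())
  buchweitz-set 1 = mk⇔ (λ { (s≤s () , _) }) (λ { (s≤s () , _) })
  buchweitz-set 2 = mk⇔ (λ inB → ⊥-elim (¬InBuchweitz-gaps-2 c<Q (≤-reflexive Q+5≡2c) inB))
                        (λ { (s≤s (s≤s ()) , _) })
  buchweitz-set (suc (suc (suc j))) with j ≤? k
  ... | yes j≤k = mk⇔ (λ _ → s≤s (s≤s (s≤s z≤n)) , ≤-trans (+-monoʳ-≤ 3 j≤k) (≤-reflexive (+-comm 3 k)))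
                      (λ _ → buchweitz-member j j≤k)
  ... | no j≰k = mk⇔ (λ inB → ⊥-elim (buchweitz-nonmember j (≰⇒> j≰k) inB))
                     (λ (_ , 3+j≤k+3) →
                        ⊥-elim (j≰k (+-cancelˡ-≤ 3 j k (≤-trans 3+j≤k+3 (≤-reflexive (+-comm k 3))))))

proposition3p5 : (k : ℕ) → 1 ≤ k →
    IsNumericalSemigroup (S k) × IsGapsetOf (gapset k) (S k) ×
    ((n : ℕ) → InBuchweitz (gapset k) n ⇔ (3 ≤ n × n ≤ k + 3))
proposition3p5 k _ =
  subst (λ G → IsNumericalSemigroup (λ x → ¬ x ∈ G)) (sym (gapset≡gaps k))
    (gaps-isNumericalSemigroup (c<Q k) (≤-reflexive (Q+5≡2c k))) ,
  complement-isGapsetOf (gapset k) ,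
  λ n → subst (λ G → InBuchweitz G n ⇔ (3 ≤ n × n ≤ k + 3)) (sym (gapset≡gaps k)) (buchweitz-set k n)
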